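{- Let $U\subseteq\mathbb Z$ be infinite. If $f\in LIP(U)$ and $|f(x)|$ is a prime number for infinitely many $x\in U$, then $f$ is irreducible in the ring $LIP(U)$.
   Context: For an infinite $U\subseteq\mathbb Z$, a function $f\colon U\to\mathbb Z$ is LIP on $U$ if for every finite $X\subseteq U$ there is $p\in\mathbb Z[x]$ with $p(x)=f(x)$ for all $x\in X$; $LIP(U)$ is the ring of all such functions under pointwise operations. -}

module Defs where

open import Data.Nat using (ℕ)
open import Data.Integer using (ℤ; _+_; _*_; ∣_∣; 0ℤ; 1ℤ)
open import Data.List using (List; []; _∷_)
open import Data.List.Membership.Propositional using (_∈_; _∉_)
open import Data.Product using (Σ; ∃; _×_; proj₁)
open import Data.Nat.Primality using (Prime)
open import Relation.Binary.PropositionalEquality using (_≡_)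
open import Relation.Nullary using (¬_)

-- Polynomials in ℤ[x] as coefficient lists, constant term first.
Poly : Set
Poly = List ℤ

eval : Poly → ℤ → ℤ
eval []       x = 0ℤ
eval (a ∷ as) x = a + x * eval as x

Subset : Set₁
Subset = ℤ → Set

Elem : Subset → Set
Elem U = Σ ℤ U

Infinite : (ℤ → Set) → Set
Infinite P = (xs : List ℤ) → ∃ λ x → P x × x ∉ xs

LIP : (U : Subset) → (Elem U → ℤ) → Set
LIP U f = (X : List (Elem U)) → ∃ λ (p : Poly) →
            ∀ {y} → y ∈ X → eval p (proj₁ y) ≡ f y

IsUnit : (U : Subset) → (Elem U → ℤ) → Set
IsUnit U f = ∃ λ (g : Elem U → ℤ) → LIP U g × (∀ y → f y * g y ≡ 1ℤ)

Irreducible : (U : Subset) → (Elem U → ℤ) → Set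
Irreducible U f =
  ¬ (∀ y → f y ≡ 0ℤ) ×
  ¬ IsUnit U f ×
  (∀ (g h : Elem U → ℤ) → LIP U g → LIP U h → (∀ y → f y ≡ g y * h y) →
     ¬ (¬ IsUnit U g × ¬ IsUnit U h))

-- A polynomial p satisfies (a - b) ∣ p(a) - p(b), and a LIP function agrees with a
-- polynomial on any two points, so the same holds for LIP functions on U. Let
-- f = g h with g, h nonunits of LIP(U). A LIP function with values in {±1} is its own
-- inverse, so ∣g(y)∣ ≠ 1 and ∣h(z)∣ ≠ 1 for some y, z. Where ∣f(x)∣ is prime one of
-- ∣g(x)∣, ∣h(x)∣ is 1, say ∣g(x)∣ = 1; then g(x) ≠ g(y), so
-- ∣x - y∣ ≤ ∣g(x) - g(y)∣ ≤ 1 + ∣g(y)∣. Hence the points where ∣f∣ is prime lie in two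
-- bounded intervals, contradicting their infinitude.
module Submission where

open import Defs
open import Data.Integer using (ℤ; ∣_∣; +_; -[1+_]; 0ℤ; 1ℤ; _+_; _*_; _-_)
open import Data.Product using (Σ; _×_; _,_; ∃; proj₁)
open import Data.Nat.Primality using (Prime; prime⇒irreducible; ¬prime[0]; ¬prime[1])

open import Data.Empty using (⊥-elim)
open import Data.Integer.Divisibility.Signed using (_∣_; ∣-refl; ∣m∣n⇒∣m+n; ∣n⇒∣m*n; ∣m⇒∣m*n; ∣⇒∣ᵤ)
open import Data.Integer.Properties using (i-j≡0⇒i≡j; ∣i∣≡0⇒i≡0; ∣i-j∣≤∣i∣+∣j∣; abs-*)
open import Data.Integer.Tactic.RingSolver using (solve-∀)
open import Data.List using (List; []; _∷_; map; _++_)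
open import Data.List.Membership.Propositional using (_∈_)
open import Data.List.Membership.Propositional.Properties using (∈-map⁺; ∈-++⁺ˡ; ∈-++⁺ʳ)
open import Data.List.Relation.Unary.Any using (here; there)
open import Data.Nat as ℕ using (ℕ; zero; suc; s≤s; ≢-nonZero)
open import Data.Nat.Divisibility using (divides; ∣⇒≤)
open import Data.Nat.Properties using (m*n≡1⇒m≡1; m≤n⇒m<n∨m≡n; *-comm; *-cancelˡ-≡; *-identityʳ; module ≤-Reasoning)
open import Data.Sum using (_⊎_; inj₁; inj₂; [_,_])
open import Relation.Nullary using (¬_)
open import Relation.Nullary.Decidable using (decidable-stable)
open import Relation.Binary.PropositionalEquality using (_≡_; _≢_; refl; sym; trans; cong; subst; subst₂)

eval-sub-divisible : ∀ p a b → (a - b) ∣ (eval p a - eval p b)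
eval-sub-divisible []       a b = ∣n⇒∣m*n 0ℤ ∣-refl
eval-sub-divisible (c ∷ cs) a b =
  subst ((a - b) ∣_) (sym (split c a b (eval cs a) (eval cs b)))
    (∣m∣n⇒∣m+n (∣n⇒∣m*n a (eval-sub-divisible cs a b)) (∣m⇒∣m*n (eval cs b) ∣-refl))
  where
  split : ∀ c a b u v → (c + a * u) - (c + b * v) ≡ a * (u - v) + (a - b) * v
  split = solve-∀

absAtMost : ℕ → List ℤ
absAtMost zero    = 0ℤ ∷ []
absAtMost (suc r) = + suc r ∷ -[1+ r ] ∷ absAtMost r

∈-absAtMost : ∀ {t} r → ∣ t ∣ ℕ.≤ r → t ∈ absAtMost r
∈-absAtMost {+ zero}    zero    _  = here refl
∈-absAtMost {t}         (suc r) ∣t∣≤1+r with m≤n⇒m<n∨m≡n ∣t∣≤1+r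
... | inj₁ (s≤s ∣t∣≤r) = there (there (∈-absAtMost r ∣t∣≤r))
∈-absAtMost {+ suc m}   (suc m) _ | inj₂ refl = here refl
∈-absAtMost { -[1+ m ]} (suc m) _ | inj₂ refl = there (here refl)

ball : ℤ → ℕ → List ℤ
ball c r = map (_+_ c) (absAtMost r)

∈-ball : ∀ {x c r} → ∣ x - c ∣ ℕ.≤ r → x ∈ ball c r
∈-ball {x} {c} {r} ∣x-c∣≤r =
  subst (_∈ ball c r) (c+[x-c]≡x c x) (∈-map⁺ (_+_ c) (∈-absAtMost r ∣x-c∣≤r))
  where
  c+[x-c]≡x : ∀ c x → c + (x - c) ≡ x
  c+[x-c]≡x = solve-∀

Prime-*⇒≡1 : ∀ m n → Prime (m ℕ.* n) → m ≡ 1 ⊎ n ≡ 1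
Prime-*⇒≡1 zero    n mn-prime = ⊥-elim (¬prime[0] mn-prime)
Prime-*⇒≡1 (suc m) n mn-prime with prime⇒irreducible mn-prime (divides n (*-comm (suc m) n))
... | inj₁ m+1≡1 = inj₁ m+1≡1
... | inj₂ m+1≡m+1*n =
  inj₂ (sym (*-cancelˡ-≡ 1 n (suc m) (trans (*-identityʳ (suc m)) m+1≡m+1*n)))

Prime∣*∣⇒∣∣≡1 : ∀ i j → Prime ∣ i * j ∣ → ∣ i ∣ ≡ 1 ⊎ ∣ j ∣ ≡ 1
Prime∣*∣⇒∣∣≡1 i j ij-prime = Prime-*⇒≡1 ∣ i ∣ ∣ j ∣ (subst Prime (abs-* i j) ij-prime)

module _ {U : Subset} where

  LIP-sub-divisible : ∀ {g} → LIP U g → ∀ a b → (proj₁ a - proj₁ b) ∣ (g a - g b)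
  LIP-sub-divisible lip a b with lip (a ∷ b ∷ [])
  ... | p , agrees =
    subst₂ (λ u v → (proj₁ a - proj₁ b) ∣ (u - v)) (agrees (here refl)) (agrees (there (here refl)))
      (eval-sub-divisible p (proj₁ a) (proj₁ b))

  LIP-separation : ∀ {g} → LIP U g → ∀ {a b} → g a ≢ g b →
                   ∣ proj₁ a - proj₁ b ∣ ℕ.≤ ∣ g a - g b ∣
  LIP-separation {g} lip {a} {b} ga≢gb =
    ∣⇒≤ {{≢-nonZero ∣ga-gb∣≢0}} (∣⇒∣ᵤ (LIP-sub-divisible lip a b))
    where
    ∣ga-gb∣≢0 : ∣ g a - g b ∣ ≢ 0
    ∣ga-gb∣≢0 eq = ga≢gb (i-j≡0⇒i≡j (g a) (g b) (∣i∣≡0⇒i≡0 eq))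

  IsUnit⇒∣∣≡1 : ∀ {f} → IsUnit U f → ∀ y → ∣ f y ∣ ≡ 1
  IsUnit⇒∣∣≡1 {f} (g , _ , fg≡1) y =
    m*n≡1⇒m≡1 ∣ f y ∣ ∣ g y ∣ (trans (sym (abs-* (f y) (g y))) (cong ∣_∣ (fg≡1 y)))

  ∣∣≡1⇒IsUnit : ∀ {g} → LIP U g → (∀ y → ∣ g y ∣ ≡ 1) → IsUnit U g
  ∣∣≡1⇒IsUnit {g} lip ∣g∣≡1 = g , lip , λ y → square-of-unit (g y) (∣g∣≡1 y)
    where
    square-of-unit : ∀ i → ∣ i ∣ ≡ 1 → i * i ≡ 1ℤ
    square-of-unit (+ 1)     _ = refl
    square-of-unit -[1+ 0 ] _ = refl

  ¬IsUnit⇒¬¬∃∣∣≢1 : ∀ {g} → LIP U g → ¬ IsUnit U g → ¬ ¬ ∃ λ y → ∣ g y ∣ ≢ 1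
  ¬IsUnit⇒¬¬∃∣∣≢1 {g} lip nonunit no-witness = nonunit (∣∣≡1⇒IsUnit lip λ y →
    decidable-stable (∣ g y ∣ ℕ.≟ 1) λ ∣gy∣≢1 → no-witness (y , ∣gy∣≢1))

  unit-value-near : ∀ {g} → LIP U g → ∀ {a y} → ∣ g a ∣ ≡ 1 → ∣ g y ∣ ≢ 1 →
                    proj₁ a ∈ ball (proj₁ y) (suc ∣ g y ∣)
  unit-value-near {g} lip {a} {y} ∣ga∣≡1 ∣gy∣≢1 = ∈-ball (begin
    ∣ proj₁ a - proj₁ y ∣  ≤⟨ LIP-separation lip ga≢gy ⟩
    ∣ g a - g y ∣          ≤⟨ ∣i-j∣≤∣i∣+∣j∣ (g a) (g y) ⟩
    ∣ g a ∣ ℕ.+ ∣ g y ∣    ≡⟨ cong (ℕ._+ ∣ g y ∣) ∣ga∣≡1 ⟩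
    suc ∣ g y ∣            ∎)
    where
    open ≤-Reasoning
    ga≢gy : g a ≢ g y
    ga≢gy ga≡gy = ∣gy∣≢1 (trans (cong ∣_∣ (sym ga≡gy)) ∣ga∣≡1)

  PrimeValued : (Elem U → ℤ) → ℤ → Set
  PrimeValued f x = Σ (U x) λ u → Prime ∣ f (x , u) ∣

  no-nonunit-factorisation : ∀ {f} → Infinite (PrimeValued f) →
    ∀ g h → LIP U g → LIP U h → (∀ y → f y ≡ g y * h y) → ¬ (¬ IsUnit U g × ¬ IsUnit U h)
  no-nonunit-factorisation primes g h lg lh f≡gh (ng , nh) =
    ¬IsUnit⇒¬¬∃∣∣≢1 lg ng λ (y , ∣gy∣≢1) →
    ¬IsUnit⇒¬¬∃∣∣≢1 lh nh λ (z , ∣hz∣≢1) →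
    let near = ball (proj₁ y) (suc ∣ g y ∣)
        x , (u , ∣fa∣-prime) , x∉ = primes (near ++ ball (proj₁ z) (suc ∣ h z ∣))
        a = (x , u)
    in x∉ ([ (λ ∣ga∣≡1 → ∈-++⁺ˡ (unit-value-near lg ∣ga∣≡1 ∣gy∣≢1))
           , (λ ∣ha∣≡1 → ∈-++⁺ʳ near (unit-value-near lh ∣ha∣≡1 ∣hz∣≢1)) ]
           (Prime∣*∣⇒∣∣≡1 (g a) (h a) (subst (λ v → Prime ∣ v ∣) (f≡gh a) ∣fa∣-prime)))

theorem2 : (U : Subset) → Infinite U → (f : Elem U → ℤ) → LIP U f →
    Infinite (λ x → Σ (U x) λ u → Prime ∣ f (x , u) ∣) →
    Irreducible U f
theorem2 U _ f _ primes with primes []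
... | x , (u , ∣fx∣-prime) , _ =
  (λ f≡0 → ¬prime[0] (subst (λ v → Prime ∣ v ∣) (f≡0 (x , u)) ∣fx∣-prime)) ,
  (λ unit → ¬prime[1] (subst Prime (IsUnit⇒∣∣≡1 {f = f} unit (x , u)) ∣fx∣-prime)) ,
  no-nonunit-factorisation primes
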